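{- In LP$^{\mathrm{MLN}}$ (i.e. with respect to semi-strong equivalence $\equiv_{s,s}$), the S-DL transformation is both SE-preserving and NSE-preserving.
   Context: Atoms are propositional. A rule $r$ is an expression $h_1\vee\cdots\vee h_k\leftarrow b_1,\dots,b_m,\mathit{not}\,c_1,\dots,\mathit{not}\,c_n$; write $H(r)$, $B^+(r)$, $B^-(r)$ for the sets of head, positive body and negative body atoms. A program is a finite set of rules. An interpretation $X$ satisfies $r$ iff $X\cap H(r)\neq\emptyset$ or $B^+(r)\not\subseteq X$ or $B^-(r)\cap X\neq\emptyset$. GL-reduct $P^X=\{H(r)\leftarrow B^+(r) : r\in P,\ B^-(r)\cap X=\emptyset\}$; $X$ is an ASP stable model of $P$ iff $X\models P^X$ and no proper subset of $X$ satisfies $P^X$. Weights of LP$^{\mathrm{MLN}}$ rules are omitted; $X$ is an LP$^{\mathrm{MLN}}$ stable model of $P$ iff $X$ is an ASP stable model of $\{r\in P: X\models r\}$. $P\equiv_{s,s}Q$ iff for every program $R$, $P\cup R$ and $Q\cup R$ have the same LP$^{\mathrm{MLN}}$ stable models. Programs are regarded as tuples of rules; $\langle P,Q\rangle$ is the concatenation. For a tuple $T=\langle r_1,\dots,r_n\rangle$ let $\langle S_1,\dots,S_{3n}\rangle=\langle H(r_1),B^+(r_1),B^-(r_1),\dots,H(r_n),B^+(r_n),B^-(r_n)\rangle$; for nonempty $N'\subseteq\{1,\dots,3n\}$ the independent set is $I_{N'}=\bigcap_{i\in N'}S_i\setminus\bigcup_{j\notin N'}S_j$. The S-DL transformation deletes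 some atom $a\in I$ from an independent set $I$ with $|I|>2$, i.e. removes $a$ from every rule of $T$. For a pair $T=\langle P,Q\rangle$ the result is $\langle P^-,Q^-\rangle$ with $P^-$ the first $|P|$ rules. A transformation type is SE-preserving if for every pair $\langle P,Q\rangle$ and every admissible application $P\equiv_{s,s}Q$ implies $P^-\equiv_{s,s}Q^-$, and NSE-preserving if $P\not\equiv_{s,s}Q$ implies $P^-\not\equiv_{s,s}Q^-$. -}

module Defs where

open import Data.Nat using (ℕ; _≡ᵇ_)
open import Data.Bool using (Bool; true; false; not; _∨_; T)
open import Data.List using (List; []; _∷_; _++_; map; concatMap; filterᵇ; length; lookup)
open import Data.Bool.ListAction using (any; all)
open import Data.List.Relation.Unary.All using (All)
open import Data.List.Membership.Propositional using (_∈_)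
open import Data.Fin using (Fin)
open import Data.Product using (Σ; _×_; ∃)
open import Relation.Binary.PropositionalEquality using (_≡_; _≢_)
open import Relation.Nullary using (¬_)
open import Function.Bundles using (_⇔_)

Atom : Set
Atom = ℕ

-- A rule  h1 ∨ ... ∨ hk ← b1,...,bm, not c1,...,not cn
record Rule : Set where
  constructor rule
  field
    head : List Atom
    pos  : List Atom
    neg  : List Atom
open Rule public

Program : Set
Program = List Rule

Interp : Set
Interp = Atom → Bool

satᵇ : Interp → Rule → Bool
satᵇ X r = any X (head r) ∨ not (all X (pos r)) ∨ any X (neg r)

_⊨ʳ_ : Interp → Rule → Set
X ⊨ʳ r = T (satᵇ X r)

_⊨_ : Interp → Program → Set
X ⊨ P = All (X ⊨ʳ_) P

reduct : Program → Interp → Program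
reduct [] X = []
reduct (r ∷ P) X with any X (neg r)
... | true  = reduct P X
... | false = rule (head r) (pos r) [] ∷ reduct P X

_⊂_ : Interp → Interp → Set
Y ⊂ X = (∀ a → T (Y a) → T (X a)) × ∃ λ a → T (X a) × Y a ≡ false

ASPStable : Program → Interp → Set
ASPStable P X = (X ⊨ reduct P X) × (∀ Y → Y ⊂ X → ¬ (Y ⊨ reduct P X))

satisfiedRules : Program → Interp → Program
satisfiedRules P X = filterᵇ (satᵇ X) P

LPMLNStable : Program → Interp → Set
LPMLNStable P X = ASPStable (satisfiedRules P X) X

_≡ss_ : Program → Program → Set
P ≡ss Q = ∀ (R : Program) (X : Interp) → LPMLNStable (P ++ R) X ⇔ LPMLNStable (Q ++ R) X

sets : Program → List (List Atom)
sets T = concatMap (λ r → head r ∷ pos r ∷ neg r ∷ []) T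

IndexSet : Program → Set
IndexSet T = Fin (length (sets T)) → Bool

Nonempty : {T : Program} → IndexSet T → Set
Nonempty N' = ∃ λ i → N' i ≡ true

InIndep : (T : Program) → IndexSet T → Atom → Set
InIndep T N' b = ∀ i → (N' i ≡ true → b ∈ lookup (sets T) i) × (N' i ≡ false → ¬ (b ∈ lookup (sets T) i))

IndepCardGt2 : (T : Program) → IndexSet T → Set
IndepCardGt2 T N' = Σ Atom λ b₁ → Σ Atom λ b₂ → Σ Atom λ b₃ →
  InIndep T N' b₁ × InIndep T N' b₂ × InIndep T N' b₃ × b₁ ≢ b₂ × b₁ ≢ b₃ × b₂ ≢ b₃

delAtoms : Atom → List Atom → List Atom
delAtoms a = filterᵇ (λ x → not (x ≡ᵇ a))

delRule : Atom → Rule → Rule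
delRule a r = rule (delAtoms a (head r)) (delAtoms a (pos r)) (delAtoms a (neg r))

delProg : Atom → Program → Program
delProg a = map (delRule a)

SDLAdmissible : (P Q : Program) → IndexSet (P ++ Q) → Atom → Set
SDLAdmissible P Q N' a = Nonempty {P ++ Q} N' × InIndep (P ++ Q) N' a × IndepCardGt2 (P ++ Q) N'

-- Semi-strong equivalence is characterised by pairs Y ⊆ X of interpretations: P ≡ss Q iff for
-- every such pair, Y satisfies the reduct w.r.t. X of the rules of P satisfied by X exactly when
-- it does so for Q. Conversely, a pair separating P from Q, restricted
-- to the finitely many atoms of P and Q, yields a context R consisting of the facts Y and of the
-- rules w ← x, x ← w for a fixed w ∈ X ∖ Y and every x ∈ X ∖ Y; then X is a stable model of
-- Q ∪ R but not of P ∪ R.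
--
-- The atoms of an independent set occur in exactly the same sets H(r), B⁺(r), B⁻(r), so deleting
-- one of them, a, commutes with a change of interpretation. A pair for the reduced programs lifts
-- to one for the original programs by giving a the value of another atom b of the set. A pair for
-- the original programs descends to one for the reduced programs by giving b the value a ∨ b ∨ c
-- and c the value a ∧ b ∧ c, for a third atom c of the set: in every rule b then stands in for the
-- three atoms inside disjunctions (heads, negative bodies) and c inside conjunctions (positive
-- bodies). This is where |I| > 2 is needed.
module Submission where

open import Defs
open import Data.Product using (_×_)
open import Data.List using (_++_)
open import Relation.Nullary using (¬_)

open import Data.Bool using (Bool; true; false; not; _∧_; _∨_; T; if_then_else_)
open import Data.Bool.Properties using (T-≡; T-not-≡; T-∧; ⇔→≡; ∨-zeroʳ; ∧-zeroʳ; ∧-identityʳ)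
  renaming (_≟_ to _≟ᵇ_)
open import Data.Bool.ListAction using (and; or; any; all)
open import Data.Empty using (⊥; ⊥-elim)
open import Data.List using (List; []; _∷_; [_]; map; concat; filter; filterᵇ)
open import Data.List.Properties using (map-cong-local; map-id; concatMap-++)
open import Data.List.Relation.Unary.All as All using (All; []; _∷_)
open import Data.List.Relation.Unary.All.Properties using (all⁺; all⁻; ++⁺; ++⁻; map⁺; map⁻)
open import Data.List.Relation.Unary.Any as Any using (Any; here; there)
open import Data.List.Relation.Unary.Any.Properties using (any⁺; any⁻; lookup-index)
open import Data.List.Membership.Propositional using (_∈_; find; lose)
open import Data.List.Membership.Propositional.Properties
  using (∈-filter⁺; ∈-filter⁻; ∈-++⁺ˡ; ∈-++⁺ʳ; ∈-concat⁺′)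
open import Data.Nat using (_≡ᵇ_; _≟_)
open import Data.Nat.Properties using (≡ᵇ⇒≡; ≡⇒≡ᵇ)
open import Data.List.Membership.DecPropositional _≟_ using (_∈?_)
open import Data.Product using (∃₂; _,_; proj₁; proj₂)
open import Data.Sum using (_⊎_; inj₁; inj₂)
open import Function using (_∘_; id)
open import Function.Bundles using (_⇔_; mk⇔; Equivalence)
open import Relation.Binary.PropositionalEquality using (_≡_; _≢_; refl; sym; trans; cong; subst)
open import Relation.Nullary using (yes; no; does)
open import Relation.Nullary.Decidable using (Dec; T?; _×-dec_; dec-true; decidable-stable)
open import Relation.Unary using (Decidable)

open Equivalence using (to; from)

infix 4 _takes_on_

_takes_on_ : Interp → Bool → List Atom → Set
Z takes v on L = Any (λ x → Z x ≡ v) L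

module _ {Z : Interp} where

  any≡true⇒takes : ∀ L → any Z L ≡ true → Z takes true on L
  any≡true⇒takes (x ∷ L) e with Z x in Zx
  ... | true  = here Zx
  ... | false = there (any≡true⇒takes L e)

  takes⇒any≡true : ∀ {L} → Z takes true on L → any Z L ≡ true
  takes⇒any≡true (here Zx) rewrite Zx = refl
  takes⇒any≡true (there {x} t) rewrite takes⇒any≡true t = ∨-zeroʳ (Z x)

  all≡false⇒takes : ∀ L → all Z L ≡ false → Z takes false on L
  all≡false⇒takes (x ∷ L) e with Z x in Zx
  ... | false = here Zx
  ... | true  = there (all≡false⇒takes L e)

  takes⇒all≡false : ∀ {L} → Z takes false on L → all Z L ≡ false
  takes⇒all≡false (here Zx) rewrite Zx = refl
  takes⇒all≡false (there {x} t) rewrite takes⇒all≡false t = ∧-zeroʳ (Z x)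

  takes⇒any⊎all : ∀ {L} v → Z takes v on L → any Z L ≡ v ⊎ all Z L ≡ v
  takes⇒any⊎all true  t = inj₁ (takes⇒any≡true t)
  takes⇒any⊎all false t = inj₂ (takes⇒all≡false t)

  any-attained : ∀ x L → Z takes any Z (x ∷ L) on (x ∷ L)
  any-attained x L with Z x in Zx | any Z L in anyL
  ... | true  | _     = here Zx
  ... | false | true  = there (any≡true⇒takes L anyL)
  ... | false | false = here Zx

  all-attained : ∀ x L → Z takes all Z (x ∷ L) on (x ∷ L)
  all-attained x L with Z x in Zx | all Z L in allL
  ... | false | _     = here Zx
  ... | true  | false = there (all≡false⇒takes L allL)
  ... | true  | true  = here Zx

SameValues : Interp → List Atom → Interp → List Atom → Set
SameValues Z L Z′ L′ = ∀ v → Z takes v on L ⇔ Z′ takes v on L′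

Equivalued : Interp → List Atom → Interp → List Atom → Set
Equivalued Z L Z′ L′ = any Z L ≡ any Z′ L′ × all Z L ≡ all Z′ L′

sameValues⇒equivalued : ∀ {Z L Z′ L′} → SameValues Z L Z′ L′ → Equivalued Z L Z′ L′
sameValues⇒equivalued {L = L} {L′ = L′} same =
    ⇔→≡ (mk⇔ (takes⇒any≡true ∘ to (same true) ∘ any≡true⇒takes L)
             (takes⇒any≡true ∘ from (same true) ∘ any≡true⇒takes L′))
  , ⇔→≡ (mk⇔ (takes⇒all≡false ∘ to (same false) ∘ all≡false⇒takes L)
             (takes⇒all≡false ∘ from (same false) ∘ all≡false⇒takes L′))

agree⇒equivalued : ∀ {Z Z′ L} → (∀ {x} → x ∈ L → Z x ≡ Z′ x) → Equivalued Z L Z′ L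
agree⇒equivalued agree = cong or (map-cong-local (All.tabulate agree))
                       , cong and (map-cong-local (All.tabulate agree))

infix 4 _⊆_

_⊆_ : Interp → Interp → Set
Y ⊆ X = ∀ x → T (Y x) → T (X x)

any-mono : ∀ {Y X} L → Y ⊆ X → T (any Y L) → T (any X L)
any-mono {Y} {X} L Y⊆X = any⁺ X ∘ Any.map (Y⊆X _) ∘ any⁻ Y L

all-mono : ∀ {Y X} L → Y ⊆ X → T (all Y L) → T (all X L)
all-mono {Y} {X} L Y⊆X = all⁻ X ∘ All.map (Y⊆X _) ∘ all⁺ Y L

T-ext : ∀ {x y} → (T x → T y) → (T y → T x) → x ≡ y
T-ext f g = ⇔→≡ {z = true} (mk⇔ (to T-≡ ∘ f ∘ from T-≡) (to T-≡ ∘ g ∘ from T-≡))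

positivePart : Rule → Rule
positivePart r = rule (head r) (pos r) []

-- The rule r contributes to the reduct of the rules satisfied by X exactly when X ⊨ r and
-- B⁻(r) ∩ X = ∅; seᵇ X Y r says that Y then satisfies the contributed rule.
seᵇ : Interp → Interp → Rule → Bool
seᵇ X Y r = not (satᵇ X r) ∨ any X (neg r) ∨ satᵇ Y (positivePart r)

SE : Program → Interp → Interp → Set
SE P X Y = All (λ r → T (seᵇ X Y r)) P

SE? : ∀ P X Y → Dec (SE P X Y)
SE? P X Y = All.all? (λ r → T? (seᵇ X Y r)) P

T-seᵇ : ∀ {X Y r} → T (seᵇ X Y r) ⇔ (T (satᵇ X r) → any X (neg r) ≡ false → T (satᵇ Y (positivePart r)))
T-seᵇ {X} {Y} {r} = mk⇔ (elim (satᵇ X r) (any X (neg r))) (intro (satᵇ X r) (any X (neg r)))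
  where
  elim : ∀ p q {s} → T (not p ∨ q ∨ s) → T p → q ≡ false → T s
  elim true false t _ _ = t
  intro : ∀ p q {s} → (T p → q ≡ false → T s) → T (not p ∨ q ∨ s)
  intro false q     h = _
  intro true  true  h = _
  intro true  false h = h _ refl

satᵇ-positivePart : ∀ {X} r → any X (neg r) ≡ false → satᵇ X (positivePart r) ≡ satᵇ X r
satᵇ-positivePart r unblocked rewrite unblocked = refl

SE-refl : ∀ P X → SE P X X
SE-refl P X = All.universal (λ r → from (T-seᵇ {X} {X} {r}) λ sat unblocked →
  subst T (sym (satᵇ-positivePart r unblocked)) sat) P

⊨-reduct⇔SE : ∀ P {X Y} → Y ⊨ reduct (satisfiedRules P X) X ⇔ SE P X Y
⊨-reduct⇔SE [] = mk⇔ (λ _ → []) (λ _ → [])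
⊨-reduct⇔SE (r ∷ P) {X} {Y} with satᵇ X r in sat
... | false = mk⇔ (λ ⊨P → dropped ∷ to (⊨-reduct⇔SE P) ⊨P) (from (⊨-reduct⇔SE P) ∘ All.tail)
  where
  dropped : T (seᵇ X Y r)
  dropped = from (T-seᵇ {X} {Y} {r}) λ satr → ⊥-elim (subst T sat satr)
... | true with any X (neg r) in blocked
...   | true  = mk⇔ (λ ⊨P → dropped ∷ to (⊨-reduct⇔SE P) ⊨P) (from (⊨-reduct⇔SE P) ∘ All.tail)
  where
  dropped : T (seᵇ X Y r)
  dropped = from (T-seᵇ {X} {Y} {r}) λ _ unblocked → ⊥-elim (subst T (trans (sym blocked) unblocked) _)
...   | false =
  mk⇔ (λ { (⊨r ∷ ⊨P) → from (T-seᵇ {X} {Y} {r}) (λ _ _ → ⊨r) ∷ to (⊨-reduct⇔SE P) ⊨P })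
      (λ { (se ∷ seP) → to (T-seᵇ {X} {Y} {r}) se satr blocked ∷ from (⊨-reduct⇔SE P) seP })
  where
  -- The second with has rewritten any X (neg r) to false inside sat.
  satr : T (satᵇ X r)
  satr = subst T (satᵇ-positivePart r blocked) (from T-≡ sat)

seᵇ-cong : ∀ {X Y X′ Y′ r r′} →
  Equivalued X (head r) X′ (head r′) → Equivalued X (pos r) X′ (pos r′) →
  Equivalued X (neg r) X′ (neg r′) →
  Equivalued Y (head r) Y′ (head r′) → Equivalued Y (pos r) Y′ (pos r′) →
  seᵇ X Y r ≡ seᵇ X′ Y′ r′
seᵇ-cong (Xh , _) (_ , Xp) (Xn , _) (Yh , _) (_ , Yp) rewrite Xh | Xp | Xn | Yh | Yp = refl

mapAtoms : (List Atom → List Atom) → Rule → Rule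
mapAtoms δ r = rule (δ (head r)) (δ (pos r)) (δ (neg r))

SE-mapAtoms : ∀ (δ : List Atom → List Atom) Ps {X Y X′ Y′} →
  (∀ {L} → L ∈ sets Ps → Equivalued X L X′ (δ L) × Equivalued Y L Y′ (δ L)) →
  SE Ps X Y ⇔ SE (map (mapAtoms δ) Ps) X′ Y′
SE-mapAtoms δ []       _   = mk⇔ (λ _ → []) (λ _ → [])
SE-mapAtoms δ (r ∷ Ps) {X} {Y} {X′} {Y′} eqv =
  mk⇔ (λ { (se ∷ seP) → subst T se≡ se ∷ to rest seP })
      (λ { (se ∷ seP) → subst T (sym se≡) se ∷ from rest seP })
  where
  rest = SE-mapAtoms δ Ps (eqv ∘ there ∘ there ∘ there)
  h = eqv (here refl)
  p = eqv (there (here refl))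
  n = eqv (there (there (here refl)))
  se≡ : seᵇ X Y r ≡ seᵇ X′ Y′ (mapAtoms δ r)
  se≡ = seᵇ-cong {X} {Y} {X′} {Y′} {r} {mapAtoms δ r} (proj₁ h) (proj₁ p) (proj₁ n) (proj₂ h) (proj₂ p)

atoms : Program → List Atom
atoms Ps = concat (sets Ps)

SE-local : ∀ Ps {X Y X′ Y′} → (∀ {x} → x ∈ atoms Ps → X x ≡ X′ x × Y x ≡ Y′ x) → SE Ps X Y ⇔ SE Ps X′ Y′
SE-local Ps {X} {Y} {X′} {Y′} agree =
  subst (λ Qs → SE Ps X Y ⇔ SE Qs X′ Y′) (map-id Ps) (SE-mapAtoms id Ps λ L∈ →
    agree⇒equivalued (λ x∈ → proj₁ (agree (∈-concat⁺′ x∈ L∈))) ,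
    agree⇒equivalued (λ x∈ → proj₂ (agree (∈-concat⁺′ x∈ L∈))))

-- Characterisation of semi-strong equivalence

infix 4 _⊑_

_⊑_ : Program → Program → Set
P ⊑ Q = ∀ X Y → Y ⊆ X → SE P X Y → SE Q X Y

⊑-stable : ∀ {P Q} → Q ⊑ P → ∀ R X → LPMLNStable (P ++ R) X → LPMLNStable (Q ++ R) X
⊑-stable {P} {Q} Q⊑P R X (_ , minimal) = from (⊨-reduct⇔SE (Q ++ R)) (SE-refl (Q ++ R) X) , smaller
  where
  smaller : ∀ Z → Z ⊂ X → ¬ (Z ⊨ reduct (satisfiedRules (Q ++ R) X) X)
  smaller Z Z⊂X Z⊨ =
    let seQ , seR = ++⁻ Q (to (⊨-reduct⇔SE (Q ++ R)) Z⊨)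
    in minimal Z Z⊂X (from (⊨-reduct⇔SE (P ++ R)) (++⁺ (Q⊑P X Z (proj₁ Z⊂X) seQ) seR))

⊑⇒≡ss : ∀ {P Q} → P ⊑ Q → Q ⊑ P → P ≡ss Q
⊑⇒≡ss P⊑Q Q⊑P R X = mk⇔ (⊑-stable Q⊑P R X) (⊑-stable P⊑Q R X)

≡ss-sym : ∀ {P Q} → P ≡ss Q → Q ≡ss P
≡ss-sym P≡Q R X = mk⇔ (from (P≡Q R X)) (to (P≡Q R X))

Supported : Interp → List Atom → Set
Supported X V = ∀ x → T (X x) → x ∈ V

restrict : List Atom → Interp → Interp
restrict V Z x = Z x ∧ does (x ∈? V)

restrict-agrees : ∀ {V} Z {x} → x ∈ V → restrict V Z x ≡ Z x
restrict-agrees {V} Z {x} x∈V rewrite dec-true (x ∈? V) x∈V = ∧-identityʳ (Z x)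

restrict-supported : ∀ V Z → Supported (restrict V Z) V
restrict-supported V Z x t with x ∈? V
... | yes x∈V = x∈V
... | no _    = ⊥-elim (proj₂ (to (T-∧ {Z x}) t))

restrict-mono : ∀ V {Y X} → Y ⊆ X → restrict V Y ⊆ restrict V X
restrict-mono V {Y} Y⊆X x t = let y , x∈V = to (T-∧ {Y x}) t in from T-∧ (Y⊆X x y , x∈V)

Gap : Interp → Interp → Atom → Set
Gap X Y x = T (X x) × Y x ≡ false

gap? : ∀ X Y → Decidable (Gap X Y)
gap? X Y x = T? (X x) ×-dec (Y x ≟ᵇ false)

gap-witness : ∀ Q {X Y V} → Supported X V → Y ⊆ X → ¬ SE Q X Y → Any (Gap X Y) V
gap-witness Q {X} {Y} {V} supported Y⊆X ¬seQ = decidable-stable (Any.any? (gap? X Y) V) λ noGap →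
  ¬seQ (to (SE-local Q λ {x} _ → refl , X≡Y noGap x) (SE-refl Q X))
  where
  X≡Y : ¬ Any (Gap X Y) V → ∀ x → X x ≡ Y x
  X≡Y noGap x = T-ext Y-from-X (Y⊆X x)
    where
    Y-from-X : T (X x) → T (Y x)
    Y-from-X Xx with Y x in Yx
    ... | true  = _
    ... | false = noGap (lose (supported x Xx) (Xx , Yx))

infix 5 _⇐_

_⇐_ : Atom → List Atom → Rule
y ⇐ B = rule [ y ] B []

satᵇ-definite⁺ : ∀ Z {y} B → (T (all Z B) → T (Z y)) → T (satᵇ Z (y ⇐ B))
satᵇ-definite⁺ Z {y} B h with Z y | all Z B
... | true  | _     = _
... | false | false = _
... | false | true  = h _

satᵇ-definite⁻ : ∀ Z {y} B → T (satᵇ Z (y ⇐ B)) → T (all Z B) → T (Z y)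
satᵇ-definite⁻ Z {y} B sat _ with Z y | all Z B
... | true  | _    = _
... | false | true = sat

seᵇ-definite⁺ : ∀ X Z {y} B → (T (all Z B) → T (Z y)) → T (seᵇ X Z (y ⇐ B))
seᵇ-definite⁺ X Z {y} B h = from (T-seᵇ {X} {Z} {y ⇐ B}) λ _ _ → satᵇ-definite⁺ Z B h

seᵇ-definite⁻ : ∀ X Z {y} B → T (seᵇ X Z (y ⇐ B)) → T (X y) → T (all Z B) → T (Z y)
seᵇ-definite⁻ X Z {y} B se Xy =
  satᵇ-definite⁻ Z B (to (T-seᵇ {X} {Z} {y ⇐ B}) se (satᵇ-definite⁺ X B (λ _ → Xy)) refl)

-- The facts Y bound every model of the reduct of R from below, and the rules between w and the
-- atoms of D = X ∖ Y force a proper submodel of X to drop all of D at once.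
module Distinguishing {V X Y} (supported : Supported X V) (Y⊆X : Y ⊆ X) {w} (gap : Gap X Y w) where

  D : List Atom
  D = filter (gap? X Y) V

  R : Program
  R = map (_⇐ []) (filterᵇ Y V) ++ map (_⇐ [ w ]) D ++ map (λ x → w ⇐ [ x ]) D

  gap-of : ∀ {x} → x ∈ D → Gap X Y x
  gap-of x∈D = proj₂ (∈-filter⁻ (gap? X Y) {xs = V} x∈D)

  SE-R : SE R X Y
  SE-R = ++⁺ (map⁺ (All.tabulate fact)) (++⁺ (map⁺ (All.tabulate into)) (map⁺ (All.tabulate out)))
    where
    fact : ∀ {y} → y ∈ filterᵇ Y V → T (seᵇ X Y (y ⇐ []))
    fact y∈ = seᵇ-definite⁺ X Y [] λ _ → proj₂ (∈-filter⁻ (T? ∘ Y) {xs = V} y∈)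
    into : ∀ {x} → x ∈ D → T (seᵇ X Y (x ⇐ [ w ]))
    into _ = seᵇ-definite⁺ X Y [ w ] λ Yw →
      ⊥-elim (subst T (proj₂ gap) (proj₁ (to (T-∧ {Y w}) Yw)))
    out : ∀ {x} → x ∈ D → T (seᵇ X Y (w ⇐ [ x ]))
    out {x} x∈D = seᵇ-definite⁺ X Y [ x ] λ Yx →
      ⊥-elim (subst T (proj₂ (gap-of x∈D)) (proj₁ (to (T-∧ {Y x}) Yx)))

  module _ {Z} (seR : SE R X Z) where

    SE-R-facts : ∀ y → T (Y y) → T (Z y)
    SE-R-facts y Yy = seᵇ-definite⁻ X Z [] (All.lookup (map⁻ facts) y∈) Xy _
      where
      Xy = Y⊆X y Yy
      y∈ : y ∈ filterᵇ Y V
      y∈ = ∈-filter⁺ (T? ∘ Y) (supported y Xy) Yy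
      facts = proj₁ (++⁻ (map (_⇐ []) (filterᵇ Y V)) seR)

    SE-R-cycle : ∀ {x} → x ∈ D → (T (Z w) → T (Z x)) × (T (Z x) → T (Z w))
    SE-R-cycle {x} x∈D =
        (λ Zw → seᵇ-definite⁻ X Z [ w ] (All.lookup (map⁻ into) x∈D) (proj₁ (gap-of x∈D))
                                        (from (T-∧ {Z w}) (Zw , _)))
      , (λ Zx → seᵇ-definite⁻ X Z [ x ] (All.lookup (map⁻ out) x∈D) (proj₁ gap)
                                        (from (T-∧ {Z x}) (Zx , _)))
      where
      cycle = proj₂ (++⁻ (map (_⇐ []) (filterᵇ Y V)) seR)
      into = proj₁ (++⁻ (map (_⇐ [ w ]) D) cycle)
      out = proj₂ (++⁻ (map (_⇐ [ w ]) D) cycle)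

  -- Z misses some atom u of X; by the facts u ∉ Y, so u ∈ D, and the rules through w then
  -- empty Z on all of D.
  R-forces-Y : ∀ {Z} → Z ⊂ X → SE R X Z → ∀ x → Z x ≡ Y x
  R-forces-Y {Z} (Z⊆X , u , Xu , Zu) seR x = T-ext Z⊆Y (SE-R-facts seR x)
    where
    gap-in-D : ∀ {x} → T (X x) → Y x ≡ false → x ∈ D
    gap-in-D {x} Xx Yx = ∈-filter⁺ (gap? X Y) (supported x Xx) (Xx , Yx)
    ¬Zw : ¬ T (Z w)
    ¬Zw Zw with Y u in Yu
    ... | true  = subst T Zu (SE-R-facts seR u (from T-≡ Yu))
    ... | false = subst T Zu (proj₁ (SE-R-cycle seR (gap-in-D Xu Yu)) Zw)
    Z⊆Y : T (Z x) → T (Y x)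
    Z⊆Y Zx with Y x in Yx
    ... | true  = _
    ... | false = ¬Zw (proj₂ (SE-R-cycle seR (gap-in-D (Z⊆X x Zx) Yx)) Zx)

  R-refutes : ∀ P → SE P X Y → ¬ LPMLNStable (P ++ R) X
  R-refutes P seP (_ , minimal) =
    minimal Y (Y⊆X , w , gap) (from (⊨-reduct⇔SE (P ++ R)) (++⁺ seP SE-R))

  R-confirms : ∀ Q → ¬ SE Q X Y → LPMLNStable (Q ++ R) X
  R-confirms Q ¬seQ = from (⊨-reduct⇔SE (Q ++ R)) (SE-refl (Q ++ R) X) , λ Z Z⊂X Z⊨ →
    let seQ , seR = ++⁻ Q (to (⊨-reduct⇔SE (Q ++ R)) Z⊨)
    in ¬seQ (to (SE-local Q λ {x} _ → refl , R-forces-Y Z⊂X seR x) seQ)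

≡ss⇒⊑ : ∀ {P Q} → P ≡ss Q → P ⊑ Q
≡ss⇒⊑ {P} {Q} P≡Q X Y Y⊆X seP =
  decidable-stable (SE? Q X Y) λ ¬seQ → separated (¬seQ ∘ from (SE-local Q (agree ∘ ∈-++⁺ʳ (atoms P))))
  where
  V = atoms P ++ atoms Q
  X′ = restrict V X
  Y′ = restrict V Y
  supported : Supported X′ V
  supported = restrict-supported V X
  Y′⊆X′ : Y′ ⊆ X′
  Y′⊆X′ = restrict-mono V Y⊆X
  agree : ∀ {x} → x ∈ V → X x ≡ X′ x × Y x ≡ Y′ x
  agree x∈V = sym (restrict-agrees X x∈V) , sym (restrict-agrees Y x∈V)
  separated : ¬ SE Q X′ Y′ → ⊥
  separated ¬seQ′ =
    R-refutes P (to (SE-local P (agree ∘ ∈-++⁺ˡ)) seP) (from (P≡Q R X′) (R-confirms Q ¬seQ′))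
    where
    open Distinguishing supported Y′⊆X′ (proj₂ (proj₂ (find (gap-witness Q supported Y′⊆X′ ¬seQ′))))

-- Deleting an atom of an independent set

T-not-≡ᵇ : ∀ {x a} → T (not (x ≡ᵇ a)) ⇔ x ≢ a
T-not-≡ᵇ {x} {a} = mk⇔ (λ t x≡a → subst T (to T-not-≡ t) (≡⇒≡ᵇ x a x≡a)) ≢⇒
  where
  ≢⇒ : x ≢ a → T (not (x ≡ᵇ a))
  ≢⇒ x≢a with x ≡ᵇ a in x≡ᵇa
  ... | true  = x≢a (≡ᵇ⇒≡ x a (from T-≡ x≡ᵇa))
  ... | false = _

infixl 6 _[_≔_]

_[_≔_] : Interp → Atom → Bool → Interp
(Z [ a ≔ v ]) x = if x ≡ᵇ a then v else Z x

update-≡ : ∀ Z a v → (Z [ a ≔ v ]) a ≡ v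
update-≡ Z a v rewrite to T-≡ (≡⇒≡ᵇ a a refl) = refl

update-≢ : ∀ Z {a} v {x} → x ≢ a → (Z [ a ≔ v ]) x ≡ Z x
update-≢ Z v x≢a rewrite to T-not-≡ (from T-not-≡ᵇ x≢a) = refl

update-mono : ∀ {Y X a u v} → Y ⊆ X → (T u → T v) → Y [ a ≔ u ] ⊆ X [ a ≔ v ]
update-mono {a = a} Y⊆X u⇒v x with x ≡ᵇ a
... | true  = u⇒v
... | false = Y⊆X x

∈-delAtoms⁺ : ∀ {a x L} → x ∈ L → x ≢ a → x ∈ delAtoms a L
∈-delAtoms⁺ {a} x∈L x≢a = ∈-filter⁺ (T? ∘ λ y → not (y ≡ᵇ a)) x∈L (from T-not-≡ᵇ x≢a)

∈-delAtoms⁻ : ∀ {a x L} → x ∈ delAtoms a L → x ∈ L × x ≢ a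
∈-delAtoms⁻ {a} x∈ =
  let x∈L , t = ∈-filter⁻ (T? ∘ λ y → not (y ≡ᵇ a)) x∈ in x∈L , to T-not-≡ᵇ t

Together : List Atom → List Atom → Set
Together S L = ∀ {y z} → y ∈ S → z ∈ S → y ∈ L → z ∈ L

Inseparable : List Atom → Program → Set
Inseparable S Ps = ∀ {L} → L ∈ sets Ps → Together S L

indep-inseparable : ∀ {Ts N' S} → All (InIndep Ts N') S → Inseparable S Ts
indep-inseparable {N' = N'} indep L∈ {y} {z} y∈S z∈S y∈L with N' (Any.index L∈) in N'i
... | true  = subst (z ∈_) (sym (lookup-index L∈)) (proj₁ (All.lookup indep z∈S (Any.index L∈)) N'i)
... | false =
  ⊥-elim (proj₂ (All.lookup indep y∈S (Any.index L∈)) N'i (subst (y ∈_) (lookup-index L∈) y∈L))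

inseparable-++ : ∀ {S} P Q → Inseparable S (P ++ Q) → Inseparable S P × Inseparable S Q
inseparable-++ P Q ins =
    (λ L∈ → ins (subst (_ ∈_) (sym (concatMap-++ _ P Q)) (∈-++⁺ˡ L∈)))
  , (λ L∈ → ins (subst (_ ∈_) (sym (concatMap-++ _ P Q)) (∈-++⁺ʳ (sets P) L∈)))

copy-sameValues : ∀ {a b L} Z → b ≢ a → (a ∈ L → b ∈ L) → SameValues (Z [ a ≔ Z b ]) L Z (delAtoms a L)
copy-sameValues {a} {b} {L} Z b≢a a⇒b v = mk⇔ forward backward
  where
  forward : Z [ a ≔ Z b ] takes v on L → Z takes v on delAtoms a L
  forward t with find t
  ... | x , x∈L , Ẑx≡v with x ≟ a
  ...   | yes refl = lose (∈-delAtoms⁺ (a⇒b x∈L) b≢a) (trans (sym (update-≡ Z a (Z b))) Ẑx≡v)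
  ...   | no x≢a   = lose (∈-delAtoms⁺ x∈L x≢a) (trans (sym (update-≢ Z (Z b) x≢a)) Ẑx≡v)
  backward : Z takes v on delAtoms a L → Z [ a ≔ Z b ] takes v on L
  backward t with find t
  ... | x , x∈ , Zx≡v with ∈-delAtoms⁻ x∈
  ...   | x∈L , x≢a = lose x∈L (trans (update-≢ Z (Z b) x≢a) Zx≡v)

merge : Interp → Atom → Atom → Atom → Interp
merge Z a b c = Z [ b ≔ any Z (a ∷ b ∷ c ∷ []) ] [ c ≔ all Z (a ∷ b ∷ c ∷ []) ]

merge-mono : ∀ {Y X} a b c → Y ⊆ X → merge Y a b c ⊆ merge X a b c
merge-mono a b c Y⊆X =
  update-mono (update-mono Y⊆X (any-mono (a ∷ b ∷ c ∷ []) Y⊆X)) (all-mono (a ∷ b ∷ c ∷ []) Y⊆X)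

merge-sameValues : ∀ {a b c L} Z → b ≢ a → c ≢ a → b ≢ c → Together (a ∷ b ∷ c ∷ []) L →
  SameValues Z L (merge Z a b c) (delAtoms a L)
merge-sameValues {a} {b} {c} {L} Z b≢a c≢a b≢c together v = mk⇔ forward backward
  where
  abc = a ∷ b ∷ c ∷ []
  Zb = Z [ b ≔ any Z abc ]
  Z′ = merge Z a b c
  Z′b : Z′ b ≡ any Z abc
  Z′b = trans (update-≢ Zb (all Z abc) b≢c) (update-≡ Z b (any Z abc))
  Z′c : Z′ c ≡ all Z abc
  Z′c = update-≡ Zb c (all Z abc)
  Z′x : ∀ {x} → x ≢ b → x ≢ c → Z′ x ≡ Z x
  Z′x x≢b x≢c = trans (update-≢ Zb (all Z abc) x≢c) (update-≢ Z (any Z abc) x≢b)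
  b∈ : ∀ {y} → y ∈ abc → y ∈ L → b ∈ delAtoms a L
  b∈ y∈ y∈L = ∈-delAtoms⁺ (together y∈ (there (here refl)) y∈L) b≢a
  c∈ : ∀ {y} → y ∈ abc → y ∈ L → c ∈ delAtoms a L
  c∈ y∈ y∈L = ∈-delAtoms⁺ (together y∈ (there (there (here refl))) y∈L) c≢a
  spread : ∀ {y u} → y ∈ abc → y ∈ L → Z takes u on abc → Z takes u on L
  spread y∈ y∈L t = let z , z∈ , Zz = find t in lose (together y∈ z∈ y∈L) Zz
  forward : Z takes v on L → Z′ takes v on delAtoms a L
  forward t with find t
  ... | x , x∈L , Zx≡v with x ∈? abc
  ...   | no x∉abc = lose (∈-delAtoms⁺ x∈L (x∉abc ∘ here))
                          (trans (Z′x (x∉abc ∘ there ∘ here) (x∉abc ∘ there ∘ there ∘ here)) Zx≡v)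
  ...   | yes x∈abc with takes⇒any⊎all {Z} v (lose x∈abc Zx≡v)
  ...     | inj₁ any≡v = lose (b∈ x∈abc x∈L) (trans Z′b any≡v)
  ...     | inj₂ all≡v = lose (c∈ x∈abc x∈L) (trans Z′c all≡v)
  backward : Z′ takes v on delAtoms a L → Z takes v on L
  backward t with find t
  ... | x , x∈ , Z′x≡v with ∈-delAtoms⁻ x∈ | x ≟ b | x ≟ c
  ...   | x∈L , _ | yes refl | _      =
    spread (there (here refl)) x∈L
      (subst (λ u → Z takes u on abc) (trans (sym Z′b) Z′x≡v) (any-attained {Z} a (b ∷ c ∷ [])))
  ...   | x∈L , _ | no _     | yes refl =
    spread (there (there (here refl))) x∈L
      (subst (λ u → Z takes u on abc) (trans (sym Z′c) Z′x≡v) (all-attained {Z} a (b ∷ c ∷ [])))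
  ...   | x∈L , _ | no x≢b   | no x≢c  = lose x∈L (trans (sym (Z′x x≢b x≢c)) Z′x≡v)

⊑-delete : ∀ {S a b P Q} → b ≢ a → a ∈ S → b ∈ S → Inseparable S P → Inseparable S Q →
  P ⊑ Q → delProg a P ⊑ delProg a Q
⊑-delete {S} {a} {b} {P} {Q} b≢a a∈S b∈S insP insQ P⊑Q X Y Y⊆X seP⁻ =
  to (lift Q insQ) (P⊑Q _ _ (update-mono Y⊆X (Y⊆X b)) (from (lift P insP) seP⁻))
  where
  lift : ∀ Ps → Inseparable S Ps → SE Ps (X [ a ≔ X b ]) (Y [ a ≔ Y b ]) ⇔ SE (delProg a Ps) X Y
  lift Ps ins = SE-mapAtoms (delAtoms a) Ps λ L∈ →
      sameValues⇒equivalued (copy-sameValues X b≢a (ins L∈ a∈S b∈S))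
    , sameValues⇒equivalued (copy-sameValues Y b≢a (ins L∈ a∈S b∈S))

⊑-undelete : ∀ {a b c P Q} → b ≢ a → c ≢ a → b ≢ c →
  Inseparable (a ∷ b ∷ c ∷ []) P → Inseparable (a ∷ b ∷ c ∷ []) Q →
  delProg a P ⊑ delProg a Q → P ⊑ Q
⊑-undelete {a} {b} {c} {P} {Q} b≢a c≢a b≢c insP insQ P⁻⊑Q⁻ X Y Y⊆X seP =
  from (descend Q insQ) (P⁻⊑Q⁻ _ _ (merge-mono a b c Y⊆X) (to (descend P insP) seP))
  where
  descend : ∀ Ps → Inseparable (a ∷ b ∷ c ∷ []) Ps →
    SE Ps X Y ⇔ SE (delProg a Ps) (merge X a b c) (merge Y a b c)
  descend Ps ins = SE-mapAtoms (delAtoms a) Ps λ L∈ →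
      sameValues⇒equivalued (merge-sameValues X b≢a c≢a b≢c (ins L∈))
    , sameValues⇒equivalued (merge-sameValues Y b≢a c≢a b≢c (ins L∈))

≡ss-delete⇔ : ∀ {a b c P Q} → b ≢ a → c ≢ a → b ≢ c → Inseparable (a ∷ b ∷ c ∷ []) (P ++ Q) →
  P ≡ss Q ⇔ delProg a P ≡ss delProg a Q
≡ss-delete⇔ {a} {b} {c} {P} {Q} b≢a c≢a b≢c ins = mk⇔
  (λ P≡Q → ⊑⇒≡ss (delete insP insQ (≡ss⇒⊑ {P} P≡Q))
                  (delete insQ insP (≡ss⇒⊑ {Q} (≡ss-sym {P} {Q} P≡Q))))
  (λ P⁻≡Q⁻ → ⊑⇒≡ss (⊑-undelete b≢a c≢a b≢c insP insQ (≡ss⇒⊑ {P⁻} P⁻≡Q⁻))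
                    (⊑-undelete b≢a c≢a b≢c insQ insP (≡ss⇒⊑ {Q⁻} (≡ss-sym {P⁻} {Q⁻} P⁻≡Q⁻))))
  where
  P⁻ = delProg a P
  Q⁻ = delProg a Q
  insP = proj₁ (inseparable-++ P Q ins)
  insQ = proj₂ (inseparable-++ P Q ins)
  delete : ∀ {Ps Qs} → Inseparable (a ∷ b ∷ c ∷ []) Ps → Inseparable (a ∷ b ∷ c ∷ []) Qs →
    Ps ⊑ Qs → delProg a Ps ⊑ delProg a Qs
  delete = ⊑-delete b≢a (here refl) (there (here refl))

two-besides : ∀ {Ts N'} a → IndepCardGt2 Ts N' →
  ∃₂ λ b c → InIndep Ts N' b × InIndep Ts N' c × b ≢ a × c ≢ a × b ≢ c
two-besides a (b₁ , b₂ , b₃ , i₁ , i₂ , i₃ , b₁≢b₂ , b₁≢b₃ , b₂≢b₃) with a ≟ b₁ | a ≟ b₂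
... | yes refl | _        = b₂ , b₃ , i₂ , i₃ , b₁≢b₂ ∘ sym , b₁≢b₃ ∘ sym , b₂≢b₃
... | no a≢b₁  | yes refl = b₁ , b₃ , i₁ , i₃ , b₁≢b₂ , b₂≢b₃ ∘ sym , b₁≢b₃
... | no a≢b₁  | no a≢b₂  = b₁ , b₂ , i₁ , i₂ , a≢b₁ ∘ sym , a≢b₂ ∘ sym , b₁≢b₂

theorem3 : (P Q : Program) (N' : IndexSet (P ++ Q)) (a : Atom) →
    SDLAdmissible P Q N' a →
    (P ≡ss Q → delProg a P ≡ss delProg a Q) × (¬ (P ≡ss Q) → ¬ (delProg a P ≡ss delProg a Q))
theorem3 P Q N' a (_ , a∈I , card) =
  let b , c , b∈I , c∈I , b≢a , c≢a , b≢c = two-besides {P ++ Q} {N'} a card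
      abc-inseparable = indep-inseparable {P ++ Q} {N'} (a∈I ∷ b∈I ∷ c∈I ∷ [])
      P≡Q⇔P⁻≡Q⁻ = ≡ss-delete⇔ {P = P} {Q} b≢a c≢a b≢c abc-inseparable
  in to P≡Q⇔P⁻≡Q⁻ , λ P≢Q → P≢Q ∘ from P≡Q⇔P⁻≡Q⁻
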